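{- Let $G$ be a graph on $n\ge 5$ vertices such that $\chi_s(G)=n-2$ and $\Delta(G)=n-1$. Then $G$ is not $(n-2)$-critical.
   Context: Standing assumption of the paper: all graphs are finite, undirected, simple and connected. $\Delta(G)$ is the maximum degree. A star coloring of $G$ is a proper vertex-coloring such that no path on four vertices (as a subgraph) is colored with only two colors; $\chi_s(G)$ is the minimum number of colors in a star coloring of $G$. $G$ is $k$-critical if $\chi_s(G)=k$ and $\chi_s(G-e)<\chi_s(G)$ for every edge $e$, where $G-e$ denotes deletion of the edge $e$. -}

module Defs where

open import Data.Nat using (ℕ; _≤_; _<_)
open import Data.Bool using (Bool; true; false; _∧_; not)
open import Data.Fin using (Fin)
open import Data.Fin.Properties using (_≟_)
open import Data.List using (List; filter; length)
open import Data.List.Base using ()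
open import Data.Fin.Base using ()
open import Data.Vec.Functional using ()
open import Data.Product using (Σ; ∃; _×_; _,_)
open import Data.Sum using (_⊎_)
open import Relation.Nullary using (¬_; does)
open import Relation.Nullary.Decidable using (⌊_⌋)
open import Relation.Binary.PropositionalEquality using (_≡_; _≢_)
open import Data.List using (allFin)

record Graph (n : ℕ) : Set where
  field
    adj   : Fin n → Fin n → Bool
    sym   : ∀ u v → adj u v ≡ adj v u
    irrefl : ∀ v → adj v v ≡ false

open Graph public

Adj : ∀ {n} → Graph n → Fin n → Fin n → Set
Adj G u v = adj G u v ≡ true

data Reach {n : ℕ} (G : Graph n) (u : Fin n) : Fin n → Set where
  here : Reach G u u
  step : ∀ {v w} → Reach G u v → Adj G v w → Reach G u w

Connected : ∀ {n} → Graph n → Set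
Connected G = ∀ u v → Reach G u v

degree : ∀ {n} → Graph n → Fin n → ℕ
degree {n} G v = length (filter (λ w → adj G v w Data.Bool.≟ true) (allFin n))
  where import Data.Bool

MaxDegree : ∀ {n} → Graph n → ℕ → Set
MaxDegree G d = (∃ λ v → degree G v ≡ d) × (∀ v → degree G v ≤ d)

same : ∀ {n} → Fin n → Fin n → Bool
same a b = ⌊ a ≟ b ⌋

isEdge : ∀ {n} → Fin n → Fin n → Fin n → Fin n → Bool
isEdge u v a b = (same a u ∧ same b v) Data.Bool.∨ (same a v ∧ same b u)
  where import Data.Bool

deleteEdge : ∀ {n} → Graph n → Fin n → Fin n → Graph n
deleteEdge {n} G u v = record
  { adj = λ a b → adj G a b ∧ not (isEdge u v a b)
  ; sym = λ a b → lemma a b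
  ; irrefl = λ a → irr a }
  where
  open import Data.Bool.Properties using (∨-comm)
  open import Relation.Binary.PropositionalEquality using (cong₂; refl; sym)
  sameSym : ∀ (a b : Fin n) → same a b ≡ same b a
  sameSym a b with a ≟ b | b ≟ a
  ... | Relation.Nullary.yes _ | Relation.Nullary.yes _ = refl
  ... | Relation.Nullary.no _ | Relation.Nullary.no _ = refl
  ... | Relation.Nullary.yes p | Relation.Nullary.no q = Data.Empty.⊥-elim (q (Relation.Binary.PropositionalEquality.sym p))
    where import Data.Empty
  ... | Relation.Nullary.no q | Relation.Nullary.yes p = Data.Empty.⊥-elim (q (Relation.Binary.PropositionalEquality.sym p))
    where import Data.Empty
  isEdgeSym : ∀ (a b : Fin n) → isEdge u v a b ≡ isEdge u v b a
  isEdgeSym a b with same a u | same b v | same a v | same b u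
  ... | x1 | x2 | x3 | x4 = Relation.Binary.PropositionalEquality.trans
        (∨-comm (x1 ∧ x2) (x3 ∧ x4))
        (cong₂ Data.Bool._∨_ (Data.Bool.Properties.∧-comm x3 x4) (Data.Bool.Properties.∧-comm x1 x2))
    where import Data.Bool
          import Data.Bool.Properties
  lemma : ∀ (a b : Fin n) → adj G a b ∧ not (isEdge u v a b) ≡ adj G b a ∧ not (isEdge u v b a)
  lemma a b = cong₂ (λ x y → x ∧ not y) (Graph.sym G a b) (isEdgeSym a b)
  irr : ∀ (a : Fin n) → adj G a a ∧ not (isEdge u v a a) ≡ false
  irr a rewrite Graph.irrefl G a = refl

Proper : ∀ {n k} → Graph n → (Fin n → Fin k) → Set
Proper G c = ∀ u v → Adj G u v → c u ≢ c v

IsP4 : ∀ {n} → Graph n → Fin n → Fin n → Fin n → Fin n → Set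
IsP4 G a b c d =
  (a ≢ b × a ≢ c × a ≢ d × b ≢ c × b ≢ d × c ≢ d) ×
  (Adj G a b × Adj G b c × Adj G c d)

TwoColoured : ∀ {n k} → (Fin n → Fin k) → Fin n → Fin n → Fin n → Fin n → Set
TwoColoured {k = k} col a b c d =
  Σ (Fin k) λ x → Σ (Fin k) λ y →
    (col a ≡ x ⊎ col a ≡ y) × (col b ≡ x ⊎ col b ≡ y) ×
    (col c ≡ x ⊎ col c ≡ y) × (col d ≡ x ⊎ col d ≡ y)

StarColouring : ∀ {n k} → Graph n → (Fin n → Fin k) → Set
StarColouring G col =
  Proper G col ×
  (∀ a b c d → IsP4 G a b c d → ¬ TwoColoured col a b c d)

HasStarColouring : ∀ {n} → Graph n → ℕ → Set
HasStarColouring {n} G k = Σ (Fin n → Fin k) λ col → StarColouring G col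

StarChromatic : ∀ {n} → Graph n → ℕ → Set
StarChromatic G k = HasStarColouring G k × (∀ m → HasStarColouring G m → k ≤ m)

Critical : ∀ {n} → Graph n → ℕ → Set
Critical G k =
  StarChromatic G k ×
  (∀ u v → Adj G u v → Σ ℕ λ m → m < k × StarChromatic (deleteEdge G u v) m)

-- Let v be a vertex of degree n − 1 and u any other vertex. Suppose G − vu had a star
-- colouring with m < n − 2 colours. Since v is adjacent to everything except possibly u,
-- its colour is carried by no vertex besides perhaps u. If u has a colour of its own, v's
-- colour is unique, so v lies on no bicoloured P4 and the edge vu can be put back. If u
-- shares v's colour, then no neighbour y of u shares its colour with any y′ ≠ u (otherwise
-- y′ v y u is a bicoloured P4); as m < n − 2, two vertices z, z′ other than u, v share a
-- colour, and recolouring u with it gives a star colouring in which u and v differ. Either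
-- way G itself has a star colouring with m < χ_s(G) colours.
module Submission where

open import Defs hiding (sym)
open import Data.Bool using (true; false; _∧_) renaming (_≟_ to _≟ᵇ_)
open import Data.Fin as Fin using (Fin; zero; punchIn; punchOut)
open import Data.Fin.Properties
  using (_≟_; pigeonhole; punchIn-injective; punchInᵢ≢i; punchIn-punchOut; <⇒≢)
open import Data.List using (List; _∷_; filter; length; allFin)
open import Data.List.Properties using (filter-notAll; length-tabulate)
open import Data.List.Relation.Unary.Any using (here; there)
import Data.List.Relation.Unary.Any as Any
open import Data.List.Membership.Propositional using (_∈_)
open import Data.List.Membership.Propositional.Properties using (∈-allFin)
open import Data.Nat using (ℕ; suc; _+_; _≤_; _<_; _∸_; s≤s)
open import Data.Nat.Properties using (m≤n⇒m≤1+n; ≤-trans; ≤-reflexive; <-irrefl; <⇒≱)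
open import Data.Product using (∃; ∃₂; _×_; _,_; proj₁)
open import Data.Sum using (_⊎_; inj₁; inj₂)
open import Data.Vec.Functional using (updateAt)
open import Data.Vec.Functional.Properties using (updateAt-updates; updateAt-minimal)
open import Function using (const; _∘_)
open import Relation.Nullary using (¬_; yes; no; contradiction)
open import Relation.Unary using (Pred; Decidable)
open import Relation.Binary.PropositionalEquality using (_≡_; _≢_; refl; sym; trans; subst; ≢-sym)

private
  variable
    n k : ℕ

length-filter-two-rejected : ∀ {a p} {A : Set a} {P : Pred A p} (P? : Decidable P)
  {xs : List A} {x y : A} → x ∈ xs → y ∈ xs → x ≢ y → ¬ P x → ¬ P y →
  2 + length (filter P? xs) ≤ length xs
length-filter-two-rejected P? (here refl) (here refl) x≢y _ _ = contradiction refl x≢y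
length-filter-two-rejected P? {x ∷ xs} (here refl) (there y∈) _ ¬px ¬py with P? x
... | yes px = contradiction px ¬px
... | no _   = s≤s (filter-notAll P? xs (Any.map (λ { refl → ¬py }) y∈))
length-filter-two-rejected P? {z ∷ xs} (there x∈) (here refl) _ ¬px ¬py with P? z
... | yes pz = contradiction pz ¬py
... | no _   = s≤s (filter-notAll P? xs (Any.map (λ { refl → ¬px }) x∈))
length-filter-two-rejected P? {z ∷ xs} (there x∈) (there y∈) x≢y ¬px ¬py with P? z
... | yes _ = s≤s (length-filter-two-rejected P? x∈ y∈ x≢y ¬px ¬py)
... | no _  = m≤n⇒m≤1+n (length-filter-two-rejected P? x∈ y∈ x≢y ¬px ¬py)

Adj⇒≢ : (G : Graph n) {a b : Fin n} → Adj G a b → a ≢ b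
Adj⇒≢ G {a} e refl with () ← trans (sym e) (irrefl G a)

Adj-sym : (G : Graph n) {a b : Fin n} → Adj G a b → Adj G b a
Adj-sym G {a} {b} e = trans (Graph.sym G b a) e

degree≡n∸1⇒adjacent : (G : Graph n) {v : Fin n} → degree G v ≡ n ∸ 1 →
  ∀ w → w ≢ v → Adj G v w
degree≡n∸1⇒adjacent {suc n} G {v} deg w w≢v with adj G v w in vw
... | true  = refl
... | false = contradiction (subst (λ d → 2 + d ≤ suc n) deg both-rejected) (<-irrefl refl)
  where
  both-rejected : 2 + length (filter (λ x → adj G v x ≟ᵇ true) (allFin (suc n))) ≤ suc n
  both-rejected = ≤-trans
    (length-filter-two-rejected (λ x → adj G v x ≟ᵇ true) (∈-allFin v) (∈-allFin w)
      (≢-sym w≢v) (λ e → Adj⇒≢ G e refl)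
      (λ e → contradiction (trans (sym e) vw) λ ()))
    (≤-reflexive (length-tabulate (λ i → i)))

same∧same≡false : {a b u v : Fin n} → ¬ (a ≡ u × b ≡ v) → same a u ∧ same b v ≡ false
same∧same≡false {a = a} {b} {u} {v} ¬eq with a ≟ u | b ≟ v
... | yes a≡u | yes b≡v = contradiction (a≡u , b≡v) ¬eq
... | yes _   | no _    = refl
... | no _    | _       = refl

deleteEdge-keeps : (G : Graph n) {u v a b : Fin n} → Adj G a b →
  ¬ (a ≡ u × b ≡ v) → ¬ (a ≡ v × b ≡ u) → Adj (deleteEdge G u v) a b
deleteEdge-keeps G {u} {v} {a} {b} e p q
  rewrite e | same∧same≡false {a = a} {b} {u} {v} p | same∧same≡false {a = a} {b} {v} {u} q
  = refl

deleteEdge-keeps-avoiding : (G : Graph n) {u v a b : Fin n} → Adj G a b →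
  a ≢ u → b ≢ u → Adj (deleteEdge G u v) a b
deleteEdge-keeps-avoiding G e a≢u b≢u =
  deleteEdge-keeps G e (λ (a≡u , _) → a≢u a≡u) (λ (_ , b≡u) → b≢u b≡u)

deleteEdge-keeps-incident : (G : Graph n) {u v w : Fin n} → Adj G u w →
  w ≢ v → Adj (deleteEdge G u v) u w
deleteEdge-keeps-incident G e w≢v =
  deleteEdge-keeps G e (λ (_ , w≡v) → w≢v w≡v) (λ (_ , w≡u) → Adj⇒≢ G e (sym w≡u))

Alternating : (Fin n → Fin k) → Fin n → Fin n → Fin n → Fin n → Set
Alternating col a b c d = col a ≡ col c × col b ≡ col d

UniqueColourAt : (Fin n → Fin k) → Fin n → Set
UniqueColourAt col v = ∀ w → w ≢ v → col w ≢ col v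

outer≡-twoValued : ∀ {ℓ} {A : Set ℓ} {x y p q r : A} →
  (p ≡ x ⊎ p ≡ y) → (q ≡ x ⊎ q ≡ y) → (r ≡ x ⊎ r ≡ y) → p ≢ q → q ≢ r → p ≡ r
outer≡-twoValued (inj₁ p≡x) _          (inj₁ r≡x) _   _   = trans p≡x (sym r≡x)
outer≡-twoValued (inj₂ p≡y) _          (inj₂ r≡y) _   _   = trans p≡y (sym r≡y)
outer≡-twoValued (inj₁ p≡x) (inj₁ q≡x) (inj₂ _)   p≢q _   = contradiction (trans p≡x (sym q≡x)) p≢q
outer≡-twoValued (inj₁ _)   (inj₂ q≡y) (inj₂ r≡y) _   q≢r = contradiction (trans q≡y (sym r≡y)) q≢r
outer≡-twoValued (inj₂ p≡y) (inj₂ q≡y) (inj₁ _)   p≢q _   = contradiction (trans p≡y (sym q≡y)) p≢q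
outer≡-twoValued (inj₂ _)   (inj₁ q≡x) (inj₁ r≡x) _   q≢r = contradiction (trans q≡x (sym r≡x)) q≢r

TwoColoured⇒Alternating : {G : Graph n} {col : Fin n → Fin k} {a b c d : Fin n} →
  Proper G col → IsP4 G a b c d → TwoColoured col a b c d → Alternating col a b c d
TwoColoured⇒Alternating proper (_ , ab , bc , cd) (_ , _ , ca , cb , cc , cd′) =
  outer≡-twoValued ca cb cc (proper _ _ ab) (proper _ _ bc) ,
  outer≡-twoValued cb cc cd′ (proper _ _ bc) (proper _ _ cd)

Alternating⇒TwoColoured : {col : Fin n → Fin k} {a b c d : Fin n} →
  Alternating col a b c d → TwoColoured col a b c d
Alternating⇒TwoColoured {col = col} {a} {b} (ac , bd) =
  col a , col b , inj₁ refl , inj₂ refl , inj₁ (sym ac) , inj₂ (sym bd)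

StarColouring⇒¬Alternating : {G : Graph n} {col : Fin n → Fin k} → StarColouring G col →
  ∀ {a b c d} → IsP4 G a b c d → ¬ Alternating col a b c d
StarColouring⇒¬Alternating {col = col} (_ , star) p4 alt =
  star _ _ _ _ p4 (Alternating⇒TwoColoured {col = col} alt)

starColouring-byAlternating : {G : Graph n} {col : Fin n → Fin k} → Proper G col →
  (∀ a b c d → IsP4 G a b c d → ¬ Alternating col a b c d) → StarColouring G col
starColouring-byAlternating {G = G} {col = col} proper no-alt =
  proper , λ a b c d p4 tc →
    no-alt a b c d p4 (TwoColoured⇒Alternating {G = G} {col = col} proper p4 tc)

uniqueColour-partner≢ : {col : Fin n → Fin k} {v a b : Fin n} → UniqueColourAt col v →
  a ≢ b → col a ≡ col b → a ≢ v
uniqueColour-partner≢ unique a≢b ab refl = unique _ (≢-sym a≢b) (sym ab)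

dominating⇒uniqueColour : {D : Graph n} {col : Fin n → Fin k} {u v : Fin n} →
  (∀ w → w ≢ v → w ≢ u → Adj D v w) → Proper D col → col u ≢ col v → UniqueColourAt col v
dominating⇒uniqueColour {u = u} dom proper cu≢cv w w≢v with w ≟ u
... | yes refl = cu≢cv
... | no w≢u   = λ cw≡cv → proper _ w (dom w w≢v w≢u) (sym cw≡cv)

starColouring-addEdgesAt : {G D : Graph n} {col : Fin n → Fin k} {v : Fin n} →
  (∀ a b → Adj G a b → a ≢ v → b ≢ v → Adj D a b) →
  StarColouring D col → UniqueColourAt col v → StarColouring G col
starColouring-addEdgesAt {G = G} {D} {col} {v} keeps starD unique =
  starColouring-byAlternating {G = G} proper no-alt
  where
  proper : Proper G col
  proper a b e with a ≟ v | b ≟ v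
  ... | yes refl | _        = λ ca≡cb → unique b (≢-sym (Adj⇒≢ G e)) (sym ca≡cb)
  ... | no a≢v   | yes refl = unique a a≢v
  ... | no a≢v   | no b≢v   = proj₁ starD a b (keeps a b e a≢v b≢v)

  no-alt : ∀ a b c d → IsP4 G a b c d → ¬ Alternating col a b c d
  no-alt a b c d ((ab , ac , ad , bc , bd , cd) , eab , ebc , ecd) alt@(ca , cb) =
    StarColouring⇒¬Alternating {G = D} starD
      (((ab , ac , ad , bc , bd , cd) ,
        keeps a b eab a≢v b≢v , keeps b c ebc b≢v c≢v , keeps c d ecd c≢v d≢v))
      alt
    where
    a≢v = uniqueColour-partner≢ unique ac ca
    b≢v = uniqueColour-partner≢ unique bd cb
    c≢v = uniqueColour-partner≢ unique (≢-sym ac) (sym ca)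
    d≢v = uniqueColour-partner≢ unique (≢-sym bd) (sym cb)

module _ {D : Graph n} {col : Fin n → Fin k} {u v : Fin n} (u≢v : u ≢ v)
         (dom : ∀ w → w ≢ v → w ≢ u → Adj D v w)
         (starD : StarColouring D col) (cu≡cv : col u ≡ col v) where

  neighbourOfU-colourUnique : ∀ {y y′} → Adj D y u → y′ ≢ y → y′ ≢ u → col y′ ≢ col y
  neighbourOfU-colourUnique {y} {y′} yu y′≢y y′≢u cy′≡cy =
    StarColouring⇒¬Alternating {G = D} starD
      ((y′≢v , y′≢y , y′≢u , ≢-sym y≢v , ≢-sym u≢v , Adj⇒≢ D yu) ,
       Adj-sym D (dom y′ y′≢v y′≢u) , dom y y≢v (Adj⇒≢ D yu) , yu)
      (cy′≡cy , sym cu≡cv)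
    where
    cy≢cv : col y ≢ col v
    cy≢cv cy≡cv = proj₁ starD y u yu (trans cy≡cv (sym cu≡cv))
    y≢v : y ≢ v
    y≢v refl = cy≢cv refl
    y′≢v : y′ ≢ v
    y′≢v refl = cy≢cv (sym cy′≡cy)

  recolour-separates : ∀ {z z′} → z ≢ z′ → z ≢ u → z ≢ v → z′ ≢ u → col z ≡ col z′ →
    ∃ λ col′ → StarColouring D col′ × col′ u ≢ col′ v
  recolour-separates {z} {z′} z≢z′ z≢u z≢v z′≢u cz≡cz′ =
    col′ , starColouring-byAlternating {G = D} proper′ no-alt′ , separated
    where
    col′ : Fin n → Fin k
    col′ = updateAt col u (const (col z))

    col′-u : col′ u ≡ col z
    col′-u = updateAt-updates u col

    col′-agrees : ∀ {a b} → a ≢ u → b ≢ u → col′ a ≡ col′ b → col a ≡ col b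
    col′-agrees {a} {b} a≢u b≢u eq =
      trans (sym (updateAt-minimal a u col a≢u)) (trans eq (updateAt-minimal b u col b≢u))

    col′-v : col′ v ≡ col v
    col′-v = updateAt-minimal v u col (≢-sym u≢v)

    separated : col′ u ≢ col′ v
    separated eq = proj₁ starD v z (dom z z≢v z≢u) (sym (trans (sym col′-u) (trans eq col′-v)))

    newColour-avoids : ∀ {y} → Adj D y u → col z ≢ col y
    newColour-avoids {y} yu cz≡cy with z ≟ y
    ... | yes refl =
      neighbourOfU-colourUnique yu (≢-sym z≢z′) z′≢u (trans (sym cz≡cz′) cz≡cy)
    ... | no z≢y   = neighbourOfU-colourUnique yu z≢y z≢u cz≡cy

    noPartner : ∀ {y y′} → Adj D y u → y′ ≢ y → y′ ≢ u → col′ y′ ≢ col′ y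
    noPartner yu y′≢y y′≢u eq =
      neighbourOfU-colourUnique yu y′≢y y′≢u (col′-agrees y′≢u (Adj⇒≢ D yu) eq)

    proper′ : Proper D col′
    proper′ a b e with a ≟ u | b ≟ u
    ... | yes refl | yes refl = contradiction refl (Adj⇒≢ D e)
    ... | yes refl | no b≢u   = λ eq →
      newColour-avoids (Adj-sym D e)
        (trans (sym col′-u) (trans eq (updateAt-minimal b u col b≢u)))
    ... | no a≢u   | yes refl = λ eq →
      newColour-avoids e (sym (trans (sym (updateAt-minimal a u col a≢u)) (trans eq col′-u)))
    ... | no a≢u   | no b≢u   = proj₁ starD a b e ∘ col′-agrees a≢u b≢u

    no-alt′ : ∀ a b c d → IsP4 D a b c d → ¬ Alternating col′ a b c d
    no-alt′ a b c d p4@((ab , ac , ad , bc , bd , cd) , eab , ebc , ecd) (ca , cb)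
      with a ≟ u | b ≟ u | c ≟ u | d ≟ u
    ... | yes refl | _      | _      | _      = noPartner (Adj-sym D eab) (≢-sym bd) (≢-sym ad) (sym cb)
    ... | no _   | yes refl | _      | _      = noPartner eab (≢-sym ac) (≢-sym bc) (sym ca)
    ... | no _   | no _   | yes refl | _      = noPartner (Adj-sym D ecd) bd bc cb
    ... | no _   | no _   | no _   | yes refl = noPartner ecd ac ad ca
    ... | no a≢u | no b≢u | no c≢u | no d≢u   =
      StarColouring⇒¬Alternating {G = D} starD p4
        (col′-agrees a≢u c≢u ca , col′-agrees b≢u d≢u cb)

pigeonhole-avoiding : {u v : Fin (suc (suc n))} → u ≢ v → k < n →
  (col : Fin (suc (suc n)) → Fin k) →
  ∃₂ λ z z′ → z ≢ z′ × z ≢ u × z ≢ v × z′ ≢ u × col z ≡ col z′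
pigeonhole-avoiding {u = u} {v} u≢v k<n col = transport (pigeonhole k<n (col ∘ embed))
  where
  u′ = punchOut (≢-sym u≢v)
  embed = punchIn v ∘ punchIn u′
  embed≢v : ∀ i → embed i ≢ v
  embed≢v i = punchInᵢ≢i v _
  embed≢u : ∀ i → embed i ≢ u
  embed≢u i e = punchInᵢ≢i u′ i
    (punchIn-injective v _ _ (trans e (sym (punchIn-punchOut (≢-sym u≢v)))))
  embed-injective : ∀ {i i′} → embed i ≡ embed i′ → i ≡ i′
  embed-injective = punchIn-injective u′ _ _ ∘ punchIn-injective v _ _
  transport : (∃₂ λ i i′ → i Fin.< i′ × col (embed i) ≡ col (embed i′)) →
    ∃₂ λ z z′ → z ≢ z′ × z ≢ u × z ≢ v × z′ ≢ u × col z ≡ col z′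
  transport (i , i′ , i<i′ , eq) =
    embed i , embed i′ , <⇒≢ i<i′ ∘ embed-injective , embed≢u i , embed≢v i , embed≢u i′ , eq

deleteEdge-dominating : (G : Graph n) (v u : Fin n) → (∀ w → w ≢ v → Adj G v w) →
  ∀ w → w ≢ v → w ≢ u → Adj (deleteEdge G v u) v w
deleteEdge-dominating G v u dom w w≢v = deleteEdge-keeps-incident G (dom w w≢v)

starColouring-restoreEdge : (G : Graph n) (v u : Fin n) {col : Fin n → Fin k} →
  (∀ w → w ≢ v → Adj G v w) → StarColouring (deleteEdge G v u) col → col u ≢ col v →
  StarColouring G col
starColouring-restoreEdge G v u {col} dom star cu≢cv =
  starColouring-addEdgesAt {G = G} {D = deleteEdge G v u} {v = v}
    (λ _ _ e → deleteEdge-keeps-avoiding G e) star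
    (dominating⇒uniqueColour {D = deleteEdge G v u} {col} {u}
      (deleteEdge-dominating G v u dom) (proj₁ star) cu≢cv)

starColourable-deleteEdge-atDominating : (G : Graph (suc (suc n))) (v u : Fin (suc (suc n))) →
  (∀ w → w ≢ v → Adj G v w) → u ≢ v → k < n →
  HasStarColouring (deleteEdge G v u) k → HasStarColouring G k
starColourable-deleteEdge-atDominating G v u dom u≢v k<n (col , starD) with col u ≟ col v
... | no cu≢cv = col , starColouring-restoreEdge G v u dom starD cu≢cv
... | yes cu≡cv
  with z , z′ , z≢z′ , z≢u , z≢v , z′≢u , cz≡cz′ ← pigeonhole-avoiding u≢v k<n col
  with col′ , star′ , separated ← recolour-separates {D = deleteEdge G v u} u≢v
                                    (deleteEdge-dominating G v u dom) starD cu≡cv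
                                    z≢z′ z≢u z≢v z′≢u cz≡cz′
  = col′ , starColouring-restoreEdge G v u dom star′ separated

mainTheorem19 : (n : ℕ) → 5 ≤ n → (G : Graph n) → Connected G →
    StarChromatic G (n ∸ 2) → MaxDegree G (n ∸ 1) → ¬ Critical G (n ∸ 2)
mainTheorem19 (suc (suc n)) (s≤s (s≤s _)) G _ (_ , minimal) ((v , deg-v) , _) (_ , critical) =
  noSmallerAfterDeletion (critical v u (dom u u≢v))
  where
  dom = degree≡n∸1⇒adjacent G deg-v
  u = punchIn v zero
  u≢v = punchInᵢ≢i v zero
  noSmallerAfterDeletion : ¬ ∃ λ m → m < n × StarChromatic (deleteEdge G v u) m
  noSmallerAfterDeletion (m , m<n , colouring , _) =
    <⇒≱ m<n (minimal m (starColourable-deleteEdge-atDominating G v u dom u≢v m<n colouring))
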